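{- Let $k\geq 2$ and let $H$ be a connected $k$-uniform hypergraph on $n$ vertices with at least one edge. Then in the lazy burning distribution of $H$, $Q_1=\left(0,\frac{1}{k}\right]$ and $Q_n=\left(1-\frac{1}{k},1\right)$.
   Context: A hypergraph $H=(V(H),E(H))$ has a finite nonempty vertex set and a finite collection $E(H)$ of subsets of $V(H)$ called edges (parallel edges allowed); it is $k$-uniform if every edge has exactly $k$ vertices, and connected if any two vertices are joined by a path of vertices consecutive ones of which lie in a common edge. For a proportion $p\in(0,1)$, the proportion-based propagation rule is: if at some time step at least $\lceil p|e|\rceil$ vertices of an edge $e$ are on fire, then in the next time step all vertices of $e$ catch fire; burned vertices stay burned. A set $S\subseteq V(H)$ is a lazy burning set if, setting all of $S$ on fire at once and then repeatedly applying the propagation rule, every vertex eventually catches fire; $b_{L,p}(H)$ is the minimum size of a lazy burning set. The lazy burning distribution is the partition of $(0,1)$ into the sets $Q_j=\{p\in(0,1) : b_{L,p}(H)=j\}$, $j=1,\ldots,n$.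
   Formalization: The proportion p ranges only over the rationals in $(0,1)$, so each $Q_j$ is taken as a set of rational proportions. -}

module Defs where

open import Data.Nat as ℕ using (ℕ; zero; suc)
open import Data.Integer as ℤ using (ℤ; +_)
import Data.Integer.Properties as ℤP
open import Data.Rational as ℚ using (ℚ; ceiling; _/_)
open import Data.Fin using (Fin)
open import Data.Fin.Subset using (Subset; _∪_; _∩_; ∣_∣; ⊤; ⋃)
import Data.Fin.Subset as Sub
open import Data.List using (List; map)
open import Data.List.Membership.Propositional using (_∈_)
open import Data.List.Relation.Unary.All using (All)
open import Data.Product using (Σ; ∃; _×_; _,_)
open import Data.Bool using (Bool; if_then_else_)
open import Relation.Nullary.Decidable using (⌊_⌋)
open import Relation.Binary.PropositionalEquality using (_≡_)

record Hypergraph : Set where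
  constructor hypergraph
  field
    n     : ℕ
    edges : List (Subset n)
open Hypergraph public

Uniform : ℕ → Hypergraph → Set
Uniform k H = All (λ e → ∣ e ∣ ≡ k) (edges H)

Adjacent : (H : Hypergraph) → Fin (n H) → Fin (n H) → Set
Adjacent H u v = Σ (Subset (n H)) λ e → e ∈ edges H × (u Sub.∈ e) × (v Sub.∈ e)

data Path (H : Hypergraph) : Fin (n H) → Fin (n H) → Set where
  here : ∀ {u} → Path H u u
  step : ∀ {u v w} → Adjacent H u v → Path H v w → Path H u w

Connected : Hypergraph → Set
Connected H = ∀ u v → Path H u v

ceilMul : ℚ → ℕ → ℤ
ceilMul p m = ceiling (p ℚ.* (+ m / 1))

ignites : ∀ {m} → ℚ → Subset m → Subset m → Bool
ignites p B e = ⌊ ceilMul p ∣ e ∣ ℤP.≤? + ∣ B ∩ e ∣ ⌋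

burnStep : (H : Hypergraph) → ℚ → Subset (n H) → Subset (n H)
burnStep H p B = B ∪ ⋃ (map (λ e → if ignites p B e then e else Sub.⊥) (edges H))

burnAfter : (H : Hypergraph) → ℚ → Subset (n H) → ℕ → Subset (n H)
burnAfter H p S zero    = S
burnAfter H p S (suc t) = burnStep H p (burnAfter H p S t)

LazyBurningSet : (H : Hypergraph) → ℚ → Subset (n H) → Set
LazyBurningSet H p S = ∃ λ t → burnAfter H p S t ≡ ⊤

LazyBurningNumber : (H : Hypergraph) → ℚ → ℕ → Set
LazyBurningNumber H p j =
  (∃ λ S → LazyBurningSet H p S × ∣ S ∣ ≡ j) ×
  (∀ S → LazyBurningSet H p S → j ℕ.≤ ∣ S ∣)

InQ : (H : Hypergraph) → ℕ → ℚ → Set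
InQ H j p = LazyBurningNumber H p j

-- 1/k as a rational (with 1/0 := 0, never used since k ≥ 2)
recip : ℕ → ℚ
recip zero    = ℚ.0ℚ
recip (suc m) = + 1 / suc m

{-# OPTIONS --safe #-}
module Submission where

-- Let c = ⌈p k⌉ be the number of burning vertices that ignites a k-edge.
-- If c ≤ 1, i.e. p ≤ 1/k, one burning vertex ignites every edge through it,
-- so fire spreads along paths and any single vertex burns the connected H;
-- if c ≥ 2, a set with fewer than c vertices ignites nothing and stays put.
-- Dually, if c ≤ k - 1, i.e. p ≤ 1 - 1/k, the complement of a vertex v ignites
-- an edge through v, so b ≤ n - 1; if c ≥ k, an edge ignites only when it has
-- burnt completely, so no vertex is ever added and only V burns everything.

open import Defs
open import Data.Nat as ℕ using (ℕ; zero; suc; z≤n; s≤s)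
import Data.Nat.Properties as ℕP
open import Data.Integer as ℤ using (ℤ; +_; +[1+_]; -[1+_]; 0ℤ)
import Data.Integer.Properties as ℤP
import Data.Integer.DivMod as ℤD
open import Data.Integer.Tactic.RingSolver using (solve-∀)
open import Data.Rational as ℚ using (ℚ; mkℚ; ↥_; ↧_; ceiling; toℚᵘ; 0ℚ; 1ℚ; _≤_; _<_; _-_)
import Data.Rational.Properties as ℚP
import Data.Rational.Unnormalised as ℚᵘ
import Data.Rational.Unnormalised.Properties as ℚᵘP
open import Data.Fin as Fin using (Fin; _≟_)
open import Data.Fin.Subset using (Subset; _∩_; ∣_∣; ⊤; ⊥; ⋃; _⊆_; ⁅_⁆; ∁; inside; outside)
import Data.Fin.Subset as Sub
import Data.Fin.Subset.Properties as SubP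
open import Data.Vec using ([]; _∷_)
open import Data.List using (List; []; _∷_)
open import Data.List.Membership.Propositional using (_∈_)
open import Data.List.Membership.Propositional.Properties using (∈-map⁺)
open import Data.List.Relation.Unary.Any using (here; there)
open import Data.List.Relation.Unary.All as All using (All; []; _∷_)
import Data.List.Relation.Unary.All.Properties as AllP
open import Data.Bool using (true; false; if_then_else_)
open import Data.Bool.Properties using (T-≡)
open import Data.Product using (∃; _×_; _,_; proj₁; proj₂)
open import Data.Sum using ([_,_]′)
open import Data.Empty using (⊥-elim)
open import Function using (_∘_; id; case_of_)
open import Function.Bundles using (_⇔_; mk⇔; Equivalence)
open import Function.Properties.Equivalence using () renaming (trans to ⇔-trans; sym to ⇔-sym)
open import Function.Related.Propositional using (module EquationalReasoning)
open import Relation.Nullary using (yes; no)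
open import Relation.Nullary.Decidable using (toWitness; fromWitness)
open import Relation.Binary.PropositionalEquality

open Equivalence using (to; from)

≤-/⇔*≤ : ∀ z n d → z ℤ.≤ n ℤ./ +[1+ d ] ⇔ z ℤ.* +[1+ d ] ℤ.≤ n
≤-/⇔*≤ z n d = mk⇔
  (λ z≤n/D → ℤP.≤-trans (ℤP.*-monoʳ-≤-nonNeg D z≤n/D) (ℤD.[n/d]*d≤n n D))
  (λ zD≤n → <-suc⇒≤ (ℤP.*-cancelʳ-<-nonNeg D (ℤP.≤-<-trans zD≤n n<[1+n/D]*D)))
  where
  D = +[1+ d ]
  n<[1+n/D]*D : n ℤ.< ℤ.suc (n ℤ./ D) ℤ.* D
  n<[1+n/D]*D = subst (λ q → n ℤ.< ℤ.suc q ℤ.* D) (sym (ℤD.div-pos-is-/ℕ n (suc d)))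
                  (ℤD.n<s[n/ℕd]*d n (suc d))
  <-suc⇒≤ : ∀ {i j} → i ℤ.< ℤ.suc j → i ℤ.≤ j
  <-suc⇒≤ {i} {j} i<1+j = subst (i ℤ.≤_) (ℤP.pred-suc j) (ℤP.i<j⇒i≤pred[j] i<1+j)

-i≤j⇔-j≤i : ∀ i j → ℤ.- i ℤ.≤ j ⇔ ℤ.- j ℤ.≤ i
-i≤j⇔-j≤i i j = mk⇔ (swap i j) (swap j i)
  where
  swap : ∀ i j → ℤ.- i ℤ.≤ j → ℤ.- j ℤ.≤ i
  swap i j -i≤j = subst (ℤ.- j ℤ.≤_) (ℤP.neg-involutive i) (ℤP.neg-mono-≤ -i≤j)

-i*d≤-j⇔j≤i*d : ∀ i j d → ℤ.- i ℤ.* d ℤ.≤ ℤ.- j ⇔ j ℤ.≤ i ℤ.* d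
-i*d≤-j⇔j≤i*d i j d = mk⇔
  (λ -i*d≤-j → ℤP.neg-cancel-≤ (subst (ℤ._≤ ℤ.- j) (sym (ℤP.neg-distribˡ-* i d)) -i*d≤-j))
  (λ j≤i*d → subst (ℤ._≤ ℤ.- j) (ℤP.neg-distribˡ-* i d) (ℤP.neg-mono-≤ j≤i*d))

-[-a/d]≤z⇔a≤z*d : ∀ a d z → ℤ.- (ℤ.- a ℤ./ +[1+ d ]) ℤ.≤ z ⇔ a ℤ.≤ z ℤ.* +[1+ d ]
-[-a/d]≤z⇔a≤z*d a d z = begin
  ℤ.- (ℤ.- a ℤ./ D) ℤ.≤ z    ∼⟨ -i≤j⇔-j≤i _ z ⟩
  ℤ.- z ℤ.≤ ℤ.- a ℤ./ D      ∼⟨ ≤-/⇔*≤ (ℤ.- z) (ℤ.- a) d ⟩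
  ℤ.- z ℤ.* D ℤ.≤ ℤ.- a      ∼⟨ -i*d≤-j⇔j≤i*d z a D ⟩
  a ℤ.≤ z ℤ.* D              ∎
  where
  open EquationalReasoning
  D = +[1+ d ]

-- Splitting on the sign of the numerator makes ℚ.-_, and hence ceiling, compute.
ceiling-≤⇔ : ∀ q z → ceiling q ℤ.≤ z ⇔ ↥ q ℤ.≤ z ℤ.* ↧ q
ceiling-≤⇔ (mkℚ (+ zero)   d _) = -[-a/d]≤z⇔a≤z*d (+ zero) d
ceiling-≤⇔ (mkℚ +[1+ a ] d _) = -[-a/d]≤z⇔a≤z*d +[1+ a ] d
ceiling-≤⇔ (mkℚ -[1+ a ] d _) = -[-a/d]≤z⇔a≤z*d -[1+ a ] d

≤ᵘ-/1⇔ : ∀ r z → r ℚᵘ.≤ z ℚᵘ./ 1 ⇔ ℚᵘ.↥ r ℤ.≤ z ℤ.* ℚᵘ.↧ r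
≤ᵘ-/1⇔ r z = mk⇔
  (λ r≤z → subst (ℤ._≤ z ℤ.* ℚᵘ.↧ r) (ℤP.*-identityʳ (ℚᵘ.↥ r)) (ℚᵘP.drop-*≤* r≤z))
  (λ r≤z → ℚᵘ.*≤* (subst (ℤ._≤ z ℤ.* ℚᵘ.↧ r) (sym (ℤP.*-identityʳ (ℚᵘ.↥ r))) r≤z))

toℚᵘ≤ᵘ-/1⇔ : ∀ q z → toℚᵘ q ℚᵘ.≤ z ℚᵘ./ 1 ⇔ ↥ q ℤ.≤ z ℤ.* ↧ q
toℚᵘ≤ᵘ-/1⇔ (mkℚ a d _) = ≤ᵘ-/1⇔ (ℚᵘ.mkℚᵘ a d)

≤ᵘ-respˡ-≃⇔ : ∀ {r s t} → r ℚᵘ.≃ s → r ℚᵘ.≤ t ⇔ s ℚᵘ.≤ t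
≤ᵘ-respˡ-≃⇔ r≃s = mk⇔ (ℚᵘP.≤-respˡ-≃ r≃s) (ℚᵘP.≤-respˡ-≃ (ℚᵘP.≃-sym r≃s))

ceilMul-≤⇔ : ∀ p k z → ceilMul p (suc k) ℤ.≤ z ⇔ ↥ p ℤ.* + suc k ℤ.≤ z ℤ.* ↧ p
ceilMul-≤⇔ p@(mkℚ a d _) k z = begin
  ceilMul p (suc k) ℤ.≤ z                   ∼⟨ ceiling-≤⇔ q z ⟩
  ↥ q ℤ.≤ z ℤ.* ↧ q                         ∼⟨ ⇔-sym (toℚᵘ≤ᵘ-/1⇔ q z) ⟩
  toℚᵘ q ℚᵘ.≤ z ℚᵘ./ 1                      ∼⟨ ≤ᵘ-respˡ-≃⇔ toℚᵘ-q ⟩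
  toℚᵘ p ℚᵘ.* K ℚᵘ.≤ z ℚᵘ./ 1               ∼⟨ ≤ᵘ-/1⇔ (toℚᵘ p ℚᵘ.* K) z ⟩
  a ℤ.* + suc k ℤ.≤ z ℤ.* +[1+ d ℕ.* 1 ]    ≡⟨ cong (λ m → a ℤ.* + suc k ℤ.≤ z ℤ.* +[1+ m ]) (ℕP.*-identityʳ d) ⟩
  a ℤ.* + suc k ℤ.≤ z ℤ.* +[1+ d ]          ∎
  where
  open EquationalReasoning
  K = + suc k ℚᵘ./ 1
  q = p ℚ.* ℚ.fromℚᵘ K
  toℚᵘ-q : toℚᵘ q ℚᵘ.≃ toℚᵘ p ℚᵘ.* K
  toℚᵘ-q = ℚᵘP.≃-trans (ℚP.toℚᵘ-homo-* p (ℚ.fromℚᵘ K)) (ℚᵘP.*-congˡ {toℚᵘ p} (ℚP.toℚᵘ-fromℚᵘ K))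

≤⇔toℚᵘ≤ : ∀ {p q r} → toℚᵘ q ℚᵘ.≃ r → p ≤ q ⇔ toℚᵘ p ℚᵘ.≤ r
≤⇔toℚᵘ≤ q≃r = mk⇔
  (λ p≤q → ℚᵘP.≤-respʳ-≃ q≃r (ℚP.toℚᵘ-mono-≤ p≤q))
  (λ p≤r → ℚP.toℚᵘ-cancel-≤ (ℚᵘP.≤-respʳ-≃ (ℚᵘP.≃-sym q≃r) p≤r))

<⇔<toℚᵘ : ∀ {p q r} → toℚᵘ p ℚᵘ.≃ r → p < q ⇔ r ℚᵘ.< toℚᵘ q
<⇔<toℚᵘ p≃r = mk⇔
  (λ p<q → ℚᵘP.<-respˡ-≃ p≃r (ℚP.toℚᵘ-mono-< p<q))
  (λ r<q → ℚP.toℚᵘ-cancel-< (ℚᵘP.<-respˡ-≃ (ℚᵘP.≃-sym p≃r) r<q))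

≤-recip⇔ : ∀ p k → p ≤ recip (suc k) ⇔ ↥ p ℤ.* + suc k ℤ.≤ + 1 ℤ.* ↧ p
≤-recip⇔ (mkℚ _ _ _) k =
  ⇔-trans (≤⇔toℚᵘ≤ (ℚP.toℚᵘ-fromℚᵘ (+ 1 ℚᵘ./ suc k))) (mk⇔ ℚᵘP.drop-*≤* ℚᵘ.*≤*)

toℚᵘ-1-recip : ∀ k → toℚᵘ (1ℚ - recip (suc k)) ℚᵘ.≃ + k ℚᵘ./ suc k
toℚᵘ-1-recip k = begin
  toℚᵘ (1ℚ - recip (suc k))              ≈⟨ ℚP.toℚᵘ-homo-+ 1ℚ (ℚ.- recip (suc k)) ⟩
  toℚᵘ 1ℚ ℚᵘ.+ toℚᵘ (ℚ.- recip (suc k))  ≈⟨ ℚᵘP.+-congʳ (toℚᵘ 1ℚ) toℚᵘ-neg-recip ⟩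
  ℚᵘ.1ℚᵘ ℚᵘ.- (+ 1 ℚᵘ./ suc k)            ≈⟨ ℚᵘ.*≡* (trans (ring (+ k)) (cong (λ m → + k ℤ.* + suc m) (sym (ℕP.+-identityʳ k)))) ⟩
  + k ℚᵘ./ suc k                          ∎
  where
  open ℚᵘP.≃-Reasoning
  toℚᵘ-neg-recip : toℚᵘ (ℚ.- recip (suc k)) ℚᵘ.≃ ℚᵘ.- (+ 1 ℚᵘ./ suc k)
  toℚᵘ-neg-recip = ℚᵘP.≃-trans (ℚP.toℚᵘ-homo‿- (recip (suc k))) (ℚᵘP.-‿cong (ℚP.toℚᵘ-fromℚᵘ (+ 1 ℚᵘ./ suc k)))
  ring : ∀ x → (+ 1 ℤ.* (+ 1 ℤ.+ x) ℤ.+ ℤ.- (+ 1) ℤ.* + 1) ℤ.* (+ 1 ℤ.+ x) ≡ x ℤ.* (+ 1 ℤ.+ x)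
  ring = solve-∀

1-recip<⇔ : ∀ p k → 1ℚ - recip (suc k) < p ⇔ + k ℤ.* ↧ p ℤ.< ↥ p ℤ.* + suc k
1-recip<⇔ (mkℚ _ _ _) k = ⇔-trans (<⇔<toℚᵘ (toℚᵘ-1-recip k)) (mk⇔ ℚᵘP.drop-*<* ℚᵘ.*<*)

0<ceilMul : ∀ p k → 0ℚ < p → 0ℤ ℤ.< ceilMul p (suc k)
0<ceilMul p@(mkℚ +[1+ _ ] _ _) k _ =
  ℤP.≰⇒> (λ ceil≤0 → case to (ceilMul-≤⇔ p k 0ℤ) ceil≤0 of λ { (ℤ.+≤+ ()) })
0<ceilMul (mkℚ (+ zero) _ _) _ (ℚ.*<* (ℤ.+<+ ()))
0<ceilMul (mkℚ -[1+ _ ] _ _) _ (ℚ.*<* ())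

ceilMul≤1⇔≤recip : ∀ p k → ceilMul p (suc k) ℤ.≤ + 1 ⇔ p ≤ recip (suc k)
ceilMul≤1⇔≤recip p k = ⇔-trans (ceilMul-≤⇔ p k (+ 1)) (⇔-sym (≤-recip⇔ p k))

1-recip<⇔ceilMul≰ : ∀ p k → 1ℚ - recip (suc k) < p ⇔ ceilMul p (suc k) ℤ.≰ + k
1-recip<⇔ceilMul≰ p k = mk⇔
  (λ lt ceil≤k → ℤP.<⇒≱ (to (1-recip<⇔ p k) lt) (to (ceilMul-≤⇔ p k (+ k)) ceil≤k))
  (λ ceil≰k → from (1-recip<⇔ p k) (ℤP.≰⇒> (ceil≰k ∘ from (ceilMul-≤⇔ p k (+ k)))))

⊆-⋃ : ∀ {m} {es : List (Subset m)} {e} → e ∈ es → e ⊆ ⋃ es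
⊆-⋃ (here refl) = SubP.p⊆p∪q _
⊆-⋃ {es = e′ ∷ _} (there e∈es) x∈e = SubP.q⊆p∪q e′ _ (⊆-⋃ e∈es x∈e)

⋃-⊆ : ∀ {m} {es : List (Subset m)} {B} → All (_⊆ B) es → ⋃ es ⊆ B
⋃-⊆ [] x∈⊥ = ⊥-elim (SubP.∉⊥ x∈⊥)
⋃-⊆ {es = e ∷ es} (e⊆B ∷ es⊆B) x∈ = [ e⊆B , ⋃-⊆ es⊆B ]′ (SubP.x∈p∪q⁻ e (⋃ es) x∈)

∣p∣≤∣q∩p∣⇒p⊆q : ∀ {m} (p q : Subset m) → ∣ p ∣ ℕ.≤ ∣ q ∩ p ∣ → p ⊆ q
∣p∣≤∣q∩p∣⇒p⊆q p q ∣p∣≤∣q∩p∣ {x} x∈p with x SubP.∈? q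
... | yes x∈q = x∈q
... | no  x∉q = ⊥-elim (ℕP.<⇒≱ (SubP.p⊂q⇒∣p∣<∣q∣ q∩p⊂p) ∣p∣≤∣q∩p∣)
  where
  q∩p⊂p : q ∩ p Sub.⊂ p
  q∩p⊂p = SubP.p∩q⊆q q p , x , x∈p , x∉q ∘ SubP.p∩q⊆p q p

∣p∣≤∣q∣+∣∁q∩p∣ : ∀ {m} (p q : Subset m) → ∣ p ∣ ℕ.≤ ∣ q ∣ ℕ.+ ∣ ∁ q ∩ p ∣
∣p∣≤∣q∣+∣∁q∩p∣ []            []            = z≤n
∣p∣≤∣q∣+∣∁q∩p∣ (inside  ∷ p) (inside  ∷ q) = s≤s (∣p∣≤∣q∣+∣∁q∩p∣ p q)
∣p∣≤∣q∣+∣∁q∩p∣ (inside  ∷ p) (outside ∷ q) =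
  subst (suc ∣ p ∣ ℕ.≤_) (sym (ℕP.+-suc ∣ q ∣ _)) (s≤s (∣p∣≤∣q∣+∣∁q∩p∣ p q))
∣p∣≤∣q∣+∣∁q∩p∣ (outside ∷ p) (inside  ∷ q) = ℕP.m≤n⇒m≤1+n (∣p∣≤∣q∣+∣∁q∩p∣ p q)
∣p∣≤∣q∣+∣∁q∩p∣ (outside ∷ p) (outside ∷ q) = ∣p∣≤∣q∣+∣∁q∩p∣ p q

p≡⊤⇒∣p∣≡n : ∀ {m} {p : Subset m} → p ≡ ⊤ → ∣ p ∣ ≡ m
p≡⊤⇒∣p∣≡n refl = SubP.∣⊤∣≡n _

∣∁⁅x⁆∣<n : ∀ {m} (x : Fin m) → ∣ ∁ ⁅ x ⁆ ∣ ℕ.< m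
∣∁⁅x⁆∣<n {suc m} x rewrite SubP.∣∁p∣≡n∸∣p∣ ⁅ x ⁆ | SubP.∣⁅x⁆∣≡1 x = ℕP.n<1+n m

0<∣p∣⇒nonempty : ∀ {m} (p : Subset m) → 0 ℕ.< ∣ p ∣ → Sub.Nonempty p
0<∣p∣⇒nonempty {m} p 0<∣p∣ with SubP.nonempty? p
... | yes nonempty = nonempty
... | no  empty    =
  ⊥-elim (ℕP.<⇒≢ 0<∣p∣ (sym (trans (cong ∣_∣ (SubP.Empty-unique empty)) (SubP.∣⊥∣≡0 m))))

≢[]⇒∃∈ : ∀ {A : Set} (xs : List A) → xs ≢ [] → ∃ λ x → x ∈ xs
≢[]⇒∃∈ []       []≢[] = ⊥-elim ([]≢[] refl)
≢[]⇒∃∈ (x ∷ xs) _     = x , here refl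

upper-bound : ∀ N (f : Fin N → ℕ) → ∃ λ T → ∀ i → f i ℕ.≤ T
upper-bound zero    f = 0 , λ ()
upper-bound (suc N) f with upper-bound N (f ∘ Fin.suc)
... | T , f≤T = f Fin.zero ℕ.⊔ T , λ where
  Fin.zero    → ℕP.m≤m⊔n (f Fin.zero) T
  (Fin.suc i) → ℕP.m≤n⇒m≤o⊔n (f Fin.zero) (f≤T i)

ignites⇔ : ∀ {m} p (B e : Subset m) → ignites p B e ≡ true ⇔ ceilMul p ∣ e ∣ ℤ.≤ + ∣ B ∩ e ∣
ignites⇔ p B e = mk⇔ (toWitness {a? = reached?} ∘ from T-≡) (to T-≡ ∘ fromWitness {a? = reached?})
  where reached? = ceilMul p ∣ e ∣ ℤP.≤? + ∣ B ∩ e ∣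

Stable : (H : Hypergraph) → ℚ → Subset (n H) → Set
Stable H p B = ∀ {e} → e ∈ edges H → ceilMul p ∣ e ∣ ℤ.≤ + ∣ B ∩ e ∣ → e ⊆ B

module _ (H : Hypergraph) (p : ℚ) where

  ⊆-burnStep : ∀ B → B ⊆ burnStep H p B
  ⊆-burnStep B = SubP.p⊆p∪q _

  ignited⊆burnStep : ∀ B {e} → e ∈ edges H → ceilMul p ∣ e ∣ ℤ.≤ + ∣ B ∩ e ∣ → e ⊆ burnStep H p B
  ignited⊆burnStep B {e} e∈E reached {x} x∈e =
    SubP.q⊆p∪q B _ (⊆-⋃ (∈-map⁺ _ e∈E) (subst (λ b → x Sub.∈ (if b then e else ⊥)) (sym ignited) x∈e))
    where
    ignited : ignites p B e ≡ true
    ignited = from (ignites⇔ p B e) reached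

  burnStep-stable : ∀ B → Stable H p B → burnStep H p B ≡ B
  burnStep-stable B stable = SubP.⊆-antisym burnStep⊆B (⊆-burnStep B)
    where
    contribution⊆B : ∀ {e} → e ∈ edges H → (if ignites p B e then e else ⊥) ⊆ B
    contribution⊆B {e} e∈E with ignites p B e in ignited
    ... | true  = stable e∈E (to (ignites⇔ p B e) ignited)
    ... | false = SubP.⊥⊆
    burnStep⊆B : burnStep H p B ⊆ B
    burnStep⊆B x∈ = [ id , ⋃-⊆ (AllP.map⁺ (All.tabulate contribution⊆B)) ]′ (SubP.x∈p∪q⁻ B _ x∈)

  burnAfter-stable : ∀ S → Stable H p S → ∀ t → burnAfter H p S t ≡ S
  burnAfter-stable S stable zero    = refl
  burnAfter-stable S stable (suc t) rewrite burnAfter-stable S stable t = burnStep-stable S stable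

  stable-lazy⇒≡⊤ : ∀ S → Stable H p S → LazyBurningSet H p S → S ≡ ⊤
  stable-lazy⇒≡⊤ S stable (t , burnt) = trans (sym (burnAfter-stable S stable t)) burnt

  burnAfter-mono : ∀ S {t T} → t ℕ.≤ T → burnAfter H p S t ⊆ burnAfter H p S T
  burnAfter-mono S t≤T = go (ℕP.≤⇒≤′ t≤T)
    where
    go : ∀ {t T} → t ℕ.≤′ T → burnAfter H p S t ⊆ burnAfter H p S T
    go ℕ.≤′-refl        x∈ = x∈
    go (ℕ.≤′-step t≤′T) x∈ = ⊆-burnStep _ (go t≤′T x∈)

  eventually-burnt⇒lazy : ∀ S → (∀ v → ∃ λ t → v Sub.∈ burnAfter H p S t) → LazyBurningSet H p S
  eventually-burnt⇒lazy S burnt with upper-bound (n H) (proj₁ ∘ burnt)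
  ... | T , t≤T = T , SubP.⊆-antisym SubP.⊆⊤ (λ {v} _ → burnAfter-mono S (t≤T v) (proj₂ (burnt v)))

ceilMul-edge : ∀ {k H} → Uniform k H → ∀ p {e} → e ∈ edges H → ceilMul p ∣ e ∣ ≡ ceilMul p k
ceilMul-edge uniform p e∈E = cong (ceilMul p) (All.lookup uniform e∈E)

k≤n : ∀ {k H e} → Uniform k H → e ∈ edges H → k ℕ.≤ n H
k≤n {e = e} uniform e∈E = subst (ℕ._≤ _) (All.lookup uniform e∈E) (SubP.∣p∣≤n e)

edge-nonempty : ∀ {k H e} → Uniform (suc k) H → e ∈ edges H → Sub.Nonempty e
edge-nonempty {e = e} uniform e∈E = 0<∣p∣⇒nonempty e (subst (0 ℕ.<_) (sym (All.lookup uniform e∈E)) (s≤s z≤n))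

module _ {k : ℕ} {H : Hypergraph} {p : ℚ} (uniform : Uniform k H) where

  below-threshold⇒stable : ∀ S → ceilMul p k ℤ.≰ + ∣ S ∣ → Stable H p S
  below-threshold⇒stable S ceil≰∣S∣ {e} e∈E reached = ⊥-elim (ceil≰∣S∣ (begin
    ceilMul p k      ≡⟨ ceilMul-edge uniform p e∈E ⟨
    ceilMul p ∣ e ∣  ≤⟨ reached ⟩
    + ∣ S ∩ e ∣      ≤⟨ ℤ.+≤+ (SubP.∣p∩q∣≤∣p∣ S e) ⟩
    + ∣ S ∣          ∎))
    where open ℤP.≤-Reasoning

  lazy⇒threshold≤size : ∀ {S} → LazyBurningSet H p S → ∣ S ∣ ℕ.< n H → ceilMul p k ℤ.≤ + ∣ S ∣
  lazy⇒threshold≤size {S} lazy ∣S∣<n with ceilMul p k ℤP.≤? + ∣ S ∣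
  ... | yes ceil≤∣S∣ = ceil≤∣S∣
  ... | no  ceil≰∣S∣ =
    ⊥-elim (ℕP.<⇒≢ ∣S∣<n (p≡⊤⇒∣p∣≡n (stable-lazy⇒≡⊤ H p S (below-threshold⇒stable S ceil≰∣S∣) lazy)))

  module _ (ceil≤1 : ceilMul p k ℤ.≤ + 1) where

    adjacent-ignites : ∀ B {u v} → Adjacent H u v → u Sub.∈ B → v Sub.∈ burnStep H p B
    adjacent-ignites B (e , e∈E , u∈e , v∈e) u∈B = ignited⊆burnStep H p B e∈E reached v∈e
      where
      reached : ceilMul p ∣ e ∣ ℤ.≤ + ∣ B ∩ e ∣
      reached = begin
        ceilMul p ∣ e ∣  ≡⟨ ceilMul-edge uniform p e∈E ⟩
        ceilMul p k      ≤⟨ ceil≤1 ⟩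
        + 1              ≤⟨ ℤ.+≤+ (ℕP.≤-<-trans z≤n (SubP.x∈p⇒∣p-x∣<∣p∣ (SubP.x∈p∩q⁺ (u∈B , u∈e)))) ⟩
        + ∣ B ∩ e ∣      ∎
        where open ℤP.≤-Reasoning

    path-burns : ∀ S {u w} → Path H u w → ∀ {t} → u Sub.∈ burnAfter H p S t →
                 ∃ λ t′ → w Sub.∈ burnAfter H p S t′
    path-burns S here           {t} u∈ = t , u∈
    path-burns S (step u~v v⇝w) {t} u∈ =
      path-burns S v⇝w {suc t} (adjacent-ignites (burnAfter H p S t) u~v u∈)

    singleton-lazy : Connected H → ∀ v → LazyBurningSet H p ⁅ v ⁆
    singleton-lazy connected v =
      eventually-burnt⇒lazy H p ⁅ v ⁆ (λ w → path-burns ⁅ v ⁆ (connected v w) {0} (SubP.x∈⁅x⁆ v))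

lazy⇒nonempty : ∀ {k H p S} → Uniform (suc k) H → 0ℚ < p → 0 ℕ.< n H →
                LazyBurningSet H p S → 0 ℕ.< ∣ S ∣
lazy⇒nonempty {k} {H} {p} {S} uniform 0<p 0<n lazy with ∣ S ∣ ℕ.<? n H
... | yes ∣S∣<n = ℤP.drop‿+<+ (ℤP.<-≤-trans (0<ceilMul p k 0<p) (lazy⇒threshold≤size uniform lazy ∣S∣<n))
... | no  ∣S∣≮n = ℕP.<-≤-trans 0<n (ℕP.≮⇒≥ ∣S∣≮n)

co-singleton-lazy : ∀ {k H p} → Uniform (suc k) H → ceilMul p (suc k) ℤ.≤ + k →
                    ∀ {e v} → e ∈ edges H → v Sub.∈ e → LazyBurningSet H p (∁ ⁅ v ⁆)
co-singleton-lazy {k} {H} {p} uniform ceil≤k {e} {v} e∈E v∈e = 1 , SubP.⊆-antisym SubP.⊆⊤ all-burnt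
  where
  k≤∣S∩e∣ : k ℕ.≤ ∣ ∁ ⁅ v ⁆ ∩ e ∣
  k≤∣S∩e∣ = ℕP.≤-pred (begin
    suc k                           ≡⟨ All.lookup uniform e∈E ⟨
    ∣ e ∣                           ≤⟨ ∣p∣≤∣q∣+∣∁q∩p∣ e ⁅ v ⁆ ⟩
    ∣ ⁅ v ⁆ ∣ ℕ.+ ∣ ∁ ⁅ v ⁆ ∩ e ∣   ≡⟨ cong (ℕ._+ ∣ ∁ ⁅ v ⁆ ∩ e ∣) (SubP.∣⁅x⁆∣≡1 v) ⟩
    suc ∣ ∁ ⁅ v ⁆ ∩ e ∣             ∎)
    where open ℕP.≤-Reasoning
  reached : ceilMul p ∣ e ∣ ℤ.≤ + ∣ ∁ ⁅ v ⁆ ∩ e ∣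
  reached = begin
    ceilMul p ∣ e ∣    ≡⟨ ceilMul-edge uniform p e∈E ⟩
    ceilMul p (suc k)  ≤⟨ ceil≤k ⟩
    + k                ≤⟨ ℤ.+≤+ k≤∣S∩e∣ ⟩
    + ∣ ∁ ⁅ v ⁆ ∩ e ∣  ∎
    where open ℤP.≤-Reasoning
  all-burnt : ⊤ ⊆ burnStep H p (∁ ⁅ v ⁆)
  all-burnt {x} _ with x ≟ v
  ... | yes refl = ignited⊆burnStep H p (∁ ⁅ v ⁆) e∈E reached v∈e
  ... | no  x≢v  = ⊆-burnStep H p _ (SubP.x∉p⇒x∈∁p (SubP.x≢y⇒x∉⁅y⁆ x≢v))

above-threshold⇒stable : ∀ {k H} → Uniform (suc k) H → ∀ p → ceilMul p (suc k) ℤ.≰ + k →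
                         ∀ S → Stable H p S
above-threshold⇒stable {k} uniform p ceil≰k S {e} e∈E reached =
  ∣p∣≤∣q∩p∣⇒p⊆q e S (subst (ℕ._≤ ∣ S ∩ e ∣) (sym (All.lookup uniform e∈E)) k<∣S∩e∣)
  where
  k<∣S∩e∣ : k ℕ.< ∣ S ∩ e ∣
  k<∣S∩e∣ = ℕP.≰⇒> λ ∣S∩e∣≤k → ceil≰k (begin
    ceilMul p (suc k)  ≡⟨ ceilMul-edge uniform p e∈E ⟨
    ceilMul p ∣ e ∣    ≤⟨ reached ⟩
    + ∣ S ∩ e ∣        ≤⟨ ℤ.+≤+ ∣S∩e∣≤k ⟩
    + k                ∎)
    where open ℤP.≤-Reasoning

lemma3p4 : (k : ℕ) → 2 ℕ.≤ k → (H : Hypergraph) → Connected H → Uniform k H → edges H ≢ [] →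
    (p : ℚ) → 0ℚ < p → p < 1ℚ →
    (InQ H 1 p ⇔ p ≤ recip k) × (InQ H (n H) p ⇔ (1ℚ - recip k) < p)
lemma3p4 (suc k-1) (s≤s 1≤k-1) H connected uniform edges≢[] p 0<p _
  with (e₀ , e₀∈E) ← ≢[]⇒∃∈ (edges H) edges≢[]
  with (v₀ , v₀∈e₀) ← edge-nonempty uniform e₀∈E
  = mk⇔ Q₁⇒ Q₁⇐ , mk⇔ Qₙ⇒ Qₙ⇐
  where
  k = suc k-1
  1<n : 1 ℕ.< n H
  1<n = ℕP.<-≤-trans (s≤s 1≤k-1) (k≤n uniform e₀∈E)

  Q₁⇒ : InQ H 1 p → p ≤ recip k
  Q₁⇒ ((S , lazy , ∣S∣≡1) , _) = to (ceilMul≤1⇔≤recip p k-1) (subst (λ s → ceilMul p k ℤ.≤ + s) ∣S∣≡1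
    (lazy⇒threshold≤size uniform lazy (subst (ℕ._< n H) (sym ∣S∣≡1) 1<n)))

  Q₁⇐ : p ≤ recip k → InQ H 1 p
  Q₁⇐ p≤1/k = (⁅ v₀ ⁆ , singleton-lazy uniform (from (ceilMul≤1⇔≤recip p k-1) p≤1/k) connected v₀ , SubP.∣⁅x⁆∣≡1 v₀)
            , λ S → lazy⇒nonempty uniform 0<p (ℕP.<-trans (s≤s z≤n) 1<n)

  Qₙ⇒ : InQ H (n H) p → 1ℚ - recip k < p
  Qₙ⇒ (_ , minimal) = from (1-recip<⇔ceilMul≰ p k-1) λ ceil≤k-1 →
    ℕP.<⇒≱ (∣∁⁅x⁆∣<n v₀) (minimal _ (co-singleton-lazy uniform ceil≤k-1 e₀∈E v₀∈e₀))

  Qₙ⇐ : 1ℚ - recip k < p → InQ H (n H) p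
  Qₙ⇐ 1-1/k<p = (⊤ , (0 , refl) , SubP.∣⊤∣≡n (n H)) , λ S lazy →
    ℕP.≤-reflexive (sym (p≡⊤⇒∣p∣≡n (stable-lazy⇒≡⊤ H p S (above-threshold⇒stable uniform p ceil≰k-1 S) lazy)))
    where
    ceil≰k-1 : ceilMul p k ℤ.≰ + k-1
    ceil≰k-1 = to (1-recip<⇔ceilMul≰ p k-1) 1-1/k<p
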